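{- For any positive integers $a,b,c$, $\mu_{\mathrm{int}}(S_{a,b,c})\le 2$ and $\mu_{\mathrm{int}}(M_{a,b,c})\le 2$.
   Context: Graphs are finite and simple. A $k$-improper edge coloring of a graph $G$ is a map $\alpha:E(G)\to\mathbb{N}$ such that at most $k$ edges with a common endpoint receive the same color; it is an improper interval coloring if at every vertex the colors on incident edges form a set of consecutive integers. $\mu_{\mathrm{int}}(G)$ is the smallest $k$ such that $G$ has a $k$-improper interval edge coloring. The graph $S_{a,b,c}$ has vertex set $\{u_0,u_1,u_2,u_3,v_1,v_2,v_3\}\cup\{x_1,\dots,x_a,y_1,\dots,y_b,z_1,\dots,z_c\}$ and edge set $\{u_1v_1,v_1u_2,u_2v_2,v_2u_3,u_3v_3,v_3u_1\}\cup\{u_0x_i,u_1x_i:1\le i\le a\}\cup\{u_0y_j,u_2y_j:1\le j\le b\}\cup\{u_0z_k,u_3z_k:1\le k\le c\}$. The graph $M_{a,b,c}$ has vertex set $\{u_0,u_1,u_2,u_3\}\cup\{x_1,\dots,x_a,y_1,\dots,y_b,z_1,\dots,z_c\}$ and edge set $\{u_0x_i,u_1x_i,u_2x_i:1\le i\le a\}\cup\{u_0y_j,u_2y_j,u_3y_j:1\le j\le b\}\cup\{u_0z_k,u_3z_k,u_1z_k:1\le k\le c\}$. -}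

module Defs where

open import Data.Nat using (ℕ; suc; _≤_)
open import Data.Fin using (Fin)
open import Data.Product using (_×_; _,_; proj₁; proj₂; ∃)
open import Data.Sum using (_⊎_)
open import Data.Empty using (⊥)
open import Relation.Binary.PropositionalEquality using (_≡_)
open import Function.Definitions using (Injective)

-- The concrete graphs below are finite and
-- simple by construction (no loops, no repeated edges).
record Graph : Set₁ where
  field
    V    : Set
    E    : Set
    ends : E → V × V

open Graph public

Incident : (G : Graph) → V G → E G → Set
Incident G v e = proj₁ (ends G e) ≡ v ⊎ proj₂ (ends G e) ≡ v

-- k-improper edge colouring: at every vertex v, no colour col is used on
-- k+1 (pairwise distinct) edges incident to v, i.e. at most k edges with a
-- common endpoint receive the same colour.
IsImproper : (k : ℕ) (G : Graph) → (E G → ℕ) → Set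
IsImproper k G α =
  (v : V G) (col : ℕ) (f : Fin (suc k) → E G) → Injective _≡_ _≡_ f →
  ((i : Fin (suc k)) → Incident G v (f i) × α (f i) ≡ col) → ⊥

IsInterval : (G : Graph) → (E G → ℕ) → Set
IsInterval G α =
  (v : V G) (e₁ e₂ : E G) (c : ℕ) →
  Incident G v e₁ → Incident G v e₂ → α e₁ ≤ c → c ≤ α e₂ →
  ∃ λ e → Incident G v e × α e ≡ c

HasImproperInterval : ℕ → Graph → Set
HasImproperInterval k G =
  ∃ λ (α : E G → ℕ) → IsImproper k G α × IsInterval G α

-- μ_int(G) ≤ m  :⇔  some k ≤ m admits a k-improper interval colouring
-- (μ_int is the least such k)
μint≤ : Graph → ℕ → Set
μint≤ G m = ∃ λ k → k ≤ m × HasImproperInterval k G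

data SVert (a b c : ℕ) : Set where
  u0 u1 u2 u3 v1 v2 v3 : SVert a b c
  x : Fin a → SVert a b c
  y : Fin b → SVert a b c
  z : Fin c → SVert a b c

data SEdge (a b c : ℕ) : Set where
  u1v1 v1u2 u2v2 v2u3 u3v3 v3u1 : SEdge a b c
  u0x u1x : Fin a → SEdge a b c
  u0y u2y : Fin b → SEdge a b c
  u0z u3z : Fin c → SEdge a b c

SEnds : ∀ {a b c} → SEdge a b c → SVert a b c × SVert a b c
SEnds u1v1    = u1 , v1
SEnds v1u2    = v1 , u2
SEnds u2v2    = u2 , v2
SEnds v2u3    = v2 , u3
SEnds u3v3    = u3 , v3
SEnds v3u1    = v3 , u1
SEnds (u0x i) = u0 , x i
SEnds (u1x i) = u1 , x i
SEnds (u0y j) = u0 , y j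
SEnds (u2y j) = u2 , y j
SEnds (u0z k) = u0 , z k
SEnds (u3z k) = u3 , z k

S : ℕ → ℕ → ℕ → Graph
S a b c = record { V = SVert a b c ; E = SEdge a b c ; ends = SEnds }

data MVert (a b c : ℕ) : Set where
  u0 u1 u2 u3 : MVert a b c
  x : Fin a → MVert a b c
  y : Fin b → MVert a b c
  z : Fin c → MVert a b c

data MEdge (a b c : ℕ) : Set where
  u0x u1x u2x : Fin a → MEdge a b c
  u0y u2y u3y : Fin b → MEdge a b c
  u0z u3z u1z : Fin c → MEdge a b c

MEnds : ∀ {a b c} → MEdge a b c → MVert a b c × MVert a b c
MEnds (u0x i) = u0 , x i
MEnds (u1x i) = u1 , x i
MEnds (u2x i) = u2 , x i
MEnds (u0y j) = u0 , y j
MEnds (u2y j) = u2 , y j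
MEnds (u3y j) = u3 , y j
MEnds (u0z k) = u0 , z k
MEnds (u3z k) = u3 , z k
MEnds (u1z k) = u1 , z k

M : ℕ → ℕ → ℕ → Graph
M a b c = record { V = MVert a b c ; E = MEdge a b c ; ends = MEnds }

-- With a, b, c the sizes, the edges at the xᵢ get the colours 1, …, a, those at the yⱼ the
-- colours a, …, a+b−1, those at the zₖ the colours a+1, …, a+c, and the few remaining edges
-- a or a+1 (in M the third edge at each xᵢ, yⱼ, zₖ gets one more than the other two).
-- At every vertex the incident edges split into two classes by a key, each class carrying
-- pairwise distinct colours that fill an interval, and the two intervals touch. So no colour
-- occurs three times at a vertex (pigeonhole on the key), and the colours at a vertex form a
-- union of two touching intervals, i.e. an interval. A class is described by a layout that
-- reads its edges off by colour; this inverse of the colouring gives both facts at once.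

module Submission where

open import Defs
open import Data.Nat using (ℕ; zero; suc; _+_; _≤_; _<_; _⊓_; _⊔_; z≤n; s≤s; s≤s⁻¹; _≤?_; _<?_)
open import Data.Nat.Properties
  using (≤-refl; ≤-trans; ≤-antisym; ≤-<-trans; <-≤-trans; <⇒≱; ≰⇒>; ≮⇒≥; n<1+n; n≤1+n;
         m≤m+n; m≤n⇒m≤1+n; +-assoc; +-comm; +-identityʳ; +-monoʳ-<; +-cancelˡ-<;
         m⊓n≤m; m⊓n≤n; m≤m⊔n; m≤n⊔m; ⊓-sel; ⊔-sel)
open import Data.Fin as Fin using (Fin; toℕ)
open import Data.Fin.Patterns using (0F; 1F)
open import Data.Fin.Properties using (toℕ<n; pigeonhole) renaming (<-irrefl to <ᶠ-irrefl)
open import Data.Vec.Functional using ([]; _∷_)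
open import Data.Product using (_×_; _,_; proj₁; proj₂; ∃; ∃₂)
open import Data.Sum using (_⊎_; inj₁; inj₂)
open import Data.Sum.Function.Propositional using (_⊎-⇔_)
open import Data.Empty using (⊥-elim)
open import Function using (_∘_; const; _⇔_; mk⇔; Equivalence)
open import Function.Construct.Composition using (_⇔-∘_)
open import Relation.Nullary using (¬_; yes; no)
open import Relation.Binary.PropositionalEquality using (_≡_; refl; sym; trans; cong₂; subst)

open Equivalence using (to; from)

private
  variable
    A : Set
    n m s lo hi lo₀ hi₀ lo₁ hi₁ t : ℕ

prepend : ∀ n → (Fin n → A) → (ℕ → A) → ℕ → A
prepend zero    f g t       = g t
prepend (suc n) f g zero    = f Fin.zero
prepend (suc n) f g (suc t) = prepend n (f ∘ Fin.suc) g t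

prepend-toℕ : ∀ (f : Fin n → A) g i → prepend n f g (toℕ i) ≡ f i
prepend-toℕ f g Fin.zero    = refl
prepend-toℕ f g (Fin.suc i) = prepend-toℕ (f ∘ Fin.suc) g i

prepend-skip : ∀ n (f : Fin n → A) g {t u} → n + t ≡ u → prepend n f g u ≡ g t
prepend-skip zero    f g refl = refl
prepend-skip (suc n) f g refl = prepend-skip n (f ∘ Fin.suc) g refl

data Position (n : ℕ) : ℕ → Set where
  inside : (i : Fin n) → Position n (toℕ i)
  beyond : (u : ℕ) → Position n (n + u)

position : ∀ n t → Position n t
position zero    t       = beyond t
position (suc n) zero    = inside Fin.zero
position (suc n) (suc t) with position n t
... | inside i = inside (Fin.suc i)
... | beyond u = beyond u

-- ⟦ L ⟧ t is the edge of colour t in the class described by L. The entries of a gap, and of a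
-- final rest, are filler edges away from the vertex, except that rest e alone describes {e}.
data Layout (A : Set) : Set where
  rest : A → Layout A
  run  : ∀ n → (Fin n → A) → Layout A → Layout A
  gap  : ℕ → A → Layout A → Layout A

⟦_⟧ : Layout A → ℕ → A
⟦ rest e    ⟧ = const e
⟦ run n f L ⟧ = prepend n f ⟦ L ⟧
⟦ gap n j L ⟧ = prepend n (const j) ⟦ L ⟧

-- Position t of L carries colour s + t; the offset s lets a layout be read inside another.
record Realises {E : Set} (P : E → Set) (col : E → ℕ) (s : ℕ) (L : Layout E) (lo hi : ℕ) : Set where
  field
    realised : ∀ t → (P (⟦ L ⟧ t) × col (⟦ L ⟧ t) ≡ s + t) ⇔ (lo ≤ t × t < hi)

open Realises

module _ {E : Set} {P : E → Set} {col : E → ℕ} where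

  realises-single : ∀ {e} → P e → Realises P col 0 (rest e) (col e) (suc (col e))
  realised (realises-single p) t =
    mk⇔ (λ { (_ , refl) → ≤-refl , n<1+n t }) (λ (le , lt) → p , ≤-antisym le (s≤s⁻¹ lt))

  realises-empty : ∀ {j} → ¬ P j → Realises P col s (rest j) lo lo
  realised (realises-empty ¬p) t = mk⇔ (⊥-elim ∘ ¬p ∘ proj₁) (λ (le , lt) → ⊥-elim (<⇒≱ lt le))

  realises-run : {f : Fin n → E} {L : Layout E} →
    (∀ i → P (f i) × col (f i) ≡ s + toℕ i) → Realises P col (s + n) L 0 m →
    Realises P col s (run n f L) 0 (n + m)
  realised (realises-run {n = n} {s = s} {f = f} {L} f-run tail) t with position n t
  ... | inside i rewrite prepend-toℕ f ⟦ L ⟧ i =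
    mk⇔ (λ _ → z≤n , <-≤-trans (toℕ<n i) (m≤m+n n _)) (λ _ → f-run i)
  ... | beyond u rewrite prepend-skip n f ⟦ L ⟧ {u} refl | sym (+-assoc s n u) =
    mk⇔ (λ h → z≤n , +-monoʳ-< n (proj₂ (to (realised tail u) h)))
        (λ (_ , lt) → from (realised tail u) (z≤n , +-cancelˡ-< n _ _ lt))

  realises-gap : ∀ {j} {L : Layout E} → ¬ P j → Realises P col (s + n) L 0 m →
    Realises P col s (gap n j L) n (n + m)
  realised (realises-gap {s = s} {n = n} {j = j} {L} ¬p tail) t with position n t
  ... | inside i rewrite prepend-toℕ (const j) ⟦ L ⟧ i =
    mk⇔ (⊥-elim ∘ ¬p ∘ proj₁) (λ (le , _) → ⊥-elim (<⇒≱ (toℕ<n i) le))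
  ... | beyond u rewrite prepend-skip n (const j) ⟦ L ⟧ {u} refl | sym (+-assoc s n u) =
    mk⇔ (λ h → m≤m+n n u , +-monoʳ-< n (proj₂ (to (realised tail u) h)))
        (λ (_ , lt) → from (realised tail u) (z≤n , +-cancelˡ-< n _ _ lt))

  realises-last-run : ∀ {f : Fin n → E} {j} → (∀ i → P (f i) × col (f i) ≡ s + toℕ i) → ¬ P j →
    Realises P col s (run n f (rest j)) 0 n
  realises-last-run {n = n} {s = s} {f} {j} f-run ¬p =
    subst (Realises P col s (run n f (rest j)) 0) (+-identityʳ n)
          (realises-run f-run (realises-empty ¬p))

ColourAt : (G : Graph) → (E G → ℕ) → V G → ℕ → Set
ColourAt G col v t = ∃ λ e → Incident G v e × col e ≡ t

IntervalAt : (G : Graph) → (E G → ℕ) → V G → Set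
IntervalAt G col v = ∃₂ λ lo hi → ∀ t → ColourAt G col v t ⇔ (lo ≤ t × t < hi)

touching-union : lo₀ ≤ hi₁ → lo₁ ≤ hi₀ →
  ((lo₀ ≤ t × t < hi₀) ⊎ (lo₁ ≤ t × t < hi₁)) ⇔ (lo₀ ⊓ lo₁ ≤ t × t < hi₀ ⊔ hi₁)
touching-union {lo₀} {hi₁} {lo₁} {hi₀} {t} lo₀≤hi₁ lo₁≤hi₀ = mk⇔ into out
  where
  into : ((lo₀ ≤ t × t < hi₀) ⊎ (lo₁ ≤ t × t < hi₁)) → lo₀ ⊓ lo₁ ≤ t × t < hi₀ ⊔ hi₁
  into (inj₁ (le , lt)) = ≤-trans (m⊓n≤m lo₀ lo₁) le , <-≤-trans lt (m≤m⊔n hi₀ hi₁)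
  into (inj₂ (le , lt)) = ≤-trans (m⊓n≤n lo₀ lo₁) le , <-≤-trans lt (m≤n⊔m hi₀ hi₁)
  out : lo₀ ⊓ lo₁ ≤ t × t < hi₀ ⊔ hi₁ → (lo₀ ≤ t × t < hi₀) ⊎ (lo₁ ≤ t × t < hi₁)
  out (le , lt) with lo₀ ≤? t | t <? hi₀
  ... | yes lo₀≤t | yes t<hi₀ = inj₁ (lo₀≤t , t<hi₀)
  ... | no lo₀≰t  | _ = inj₂ (lo₁≤t , <-≤-trans (≰⇒> lo₀≰t) lo₀≤hi₁)
    where
    lo₁≤t : lo₁ ≤ t
    lo₁≤t with ⊓-sel lo₀ lo₁
    ... | inj₁ eq = ⊥-elim (lo₀≰t (subst (_≤ t) eq le))
    ... | inj₂ eq = subst (_≤ t) eq le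
  ... | yes _     | no t≮hi₀ = inj₂ (≤-trans lo₁≤hi₀ (≮⇒≥ t≮hi₀) , t<hi₁)
    where
    t<hi₁ : t < hi₁
    t<hi₁ with ⊔-sel hi₀ hi₁
    ... | inj₁ eq = ⊥-elim (t≮hi₀ (subst (t <_) eq lt))
    ... | inj₂ eq = subst (t <_) eq lt

module _ (G : Graph) (col : E G → ℕ) where

  separating-key⇒improper : ∀ {k} (key : E G → Fin k) →
    (∀ {v e e′} → Incident G v e → Incident G v e′ → col e ≡ col e′ → key e ≡ key e′ → e ≡ e′) →
    IsImproper k G col
  separating-key⇒improper {k} key separates v c f f-injective f-at
    with i , j , i<j , same-key ← pigeonhole (n<1+n k) (key ∘ f) =
    <ᶠ-irrefl (f-injective (separates (proj₁ (f-at i)) (proj₁ (f-at j)) same-colour same-key)) i<j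
    where
    same-colour = trans (proj₂ (f-at i)) (sym (proj₂ (f-at j)))

  local-intervals⇒interval : (∀ v → IntervalAt G col v) → IsInterval G col
  local-intervals⇒interval local v e₁ e₂ t at₁ at₂ le₁ le₂ with local v
  ... | lo , hi , colours =
    from (colours t) ( ≤-trans (proj₁ (to (colours _) (e₁ , at₁ , refl))) le₁
                     , ≤-<-trans le₂ (proj₂ (to (colours _) (e₂ , at₂ , refl))))

  module _ {v : V G} (key : E G → Fin 2) (layout : Fin 2 → Layout (E G))
           (decoded : ∀ {e} → Incident G v e → ⟦ layout (key e) ⟧ (col e) ≡ e) where

    Decodes : Fin 2 → ℕ → Set
    Decodes κ t = Incident G v (⟦ layout κ ⟧ t) × col (⟦ layout κ ⟧ t) ≡ t

    colours-decoded : ∀ t → ColourAt G col v t ⇔ (Decodes 0F t ⊎ Decodes 1F t)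
    colours-decoded t = mk⇔ into out
      where
      by-class : ∀ κ → Decodes κ t → Decodes 0F t ⊎ Decodes 1F t
      by-class 0F = inj₁
      by-class 1F = inj₂
      into : ColourAt G col v t → Decodes 0F t ⊎ Decodes 1F t
      into (e , at , refl) =
        by-class (key e) (subst (λ e′ → Incident G v e′ × col e′ ≡ col e) (sym (decoded at)) (at , refl))
      out : Decodes 0F t ⊎ Decodes 1F t → ColourAt G col v t
      out (inj₁ (at , eq)) = _ , at , eq
      out (inj₂ (at , eq)) = _ , at , eq

    two-classes-interval :
      Realises (Incident G v) col 0 (layout 0F) lo₀ hi₀ →
      Realises (Incident G v) col 0 (layout 1F) lo₁ hi₁ →
      lo₀ ≤ hi₁ → lo₁ ≤ hi₀ → IntervalAt G col v
    two-classes-interval r₀ r₁ lo₀≤hi₁ lo₁≤hi₀ = _ , _ , λ t →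
      touching-union lo₀≤hi₁ lo₁≤hi₀ ⇔-∘ ((realised r₀ t ⊎-⇔ realised r₁ t) ⇔-∘ colours-decoded t)

  decoding⇒improper-interval : ∀ {k} (key : E G → Fin k) (layout : V G → Fin k → Layout (E G)) →
    (∀ {v e} → Incident G v e → ⟦ layout v (key e) ⟧ (col e) ≡ e) → (∀ v → IntervalAt G col v) →
    HasImproperInterval k G
  decoding⇒improper-interval key layout decoded local =
    col , separating-key⇒improper key separates , local-intervals⇒interval local
    where
    separates : ∀ {v e e′} → Incident G v e → Incident G v e′ →
                col e ≡ col e′ → key e ≡ key e′ → e ≡ e′
    separates {v} at at′ same-colour same-key =
      trans (sym (decoded at)) (trans (cong₂ (λ κ → ⟦ layout v κ ⟧) same-key same-colour) (decoded at′))

-- Here and in M-colouring the parameters a, b, c are one less than the paper's.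
module S-colouring (a b c : ℕ) where

  G : Graph
  G = S (suc a) (suc b) (suc c)

  col : E G → ℕ
  col (u0x i) = suc (toℕ i)
  col (u1x i) = suc (toℕ i)
  col (u0y j) = suc (a + toℕ j)
  col (u2y j) = suc (a + toℕ j)
  col (u0z k) = suc (suc (a + toℕ k))
  col (u3z k) = suc (suc (a + toℕ k))
  col v1u2    = suc a
  col u3v3    = suc a
  col u1v1    = suc (suc a)
  col u2v2    = suc (suc a)
  col v2u3    = suc (suc a)
  col v3u1    = suc (suc a)

  key : E G → Fin 2
  key (u0x _) = 0F
  key (u1x _) = 1F
  key (u0y _) = 1F
  key (u2y _) = 0F
  key (u0z _) = 0F
  key (u3z _) = 1F
  key u1v1    = 0F
  key v1u2    = 1F
  key u2v2    = 1F
  key v2u3    = 0F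
  key u3v3    = 0F
  key v3u1    = 1F

  layout : V G → Fin 2 → Layout (E G)
  layout u0 0F    = gap 1 u1v1 (run (suc a) u0x (run (suc c) u0z (rest u1v1)))
  layout u0 1F    = gap (suc a) u1v1 (run (suc b) u0y (rest u1v1))
  layout u1 0F    = rest u1v1
  layout u1 1F    = gap 1 u2v2 (run (suc a) u1x (run 1 (v3u1 ∷ []) (rest u2v2)))
  layout u2 0F    = gap (suc a) u1v1 (run (suc b) u2y (rest u1v1))
  layout u2 1F    = gap (suc a) u1v1 (run 2 (v1u2 ∷ u2v2 ∷ []) (rest u1v1))
  layout u3 0F    = gap (suc a) u1v1 (run 2 (u3v3 ∷ v2u3 ∷ []) (rest u1v1))
  layout u3 1F    = gap (suc (suc a)) u1v1 (run (suc c) u3z (rest u1v1))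
  layout v1 0F    = rest u1v1
  layout v1 1F    = rest v1u2
  layout v2 0F    = rest v2u3
  layout v2 1F    = rest u2v2
  layout v3 0F    = rest u3v3
  layout v3 1F    = rest v3u1
  layout (x i) 0F = rest (u0x i)
  layout (x i) 1F = rest (u1x i)
  layout (y j) 0F = rest (u2y j)
  layout (y j) 1F = rest (u0y j)
  layout (z k) 0F = rest (u0z k)
  layout (z k) 1F = rest (u3z k)

  decoded : ∀ {v e} → Incident G v e → ⟦ layout v (key e) ⟧ (col e) ≡ e
  decoded {e = u0x i} (inj₁ refl) = prepend-toℕ u0x _ i
  decoded {e = u0x i} (inj₂ refl) = refl
  decoded {e = u1x i} (inj₁ refl) = prepend-toℕ u1x _ i
  decoded {e = u1x i} (inj₂ refl) = refl
  decoded {e = u0y j} (inj₁ refl) = trans (prepend-skip (suc a) (const u1v1) _ refl) (prepend-toℕ u0y _ j)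
  decoded {e = u0y j} (inj₂ refl) = refl
  decoded {e = u2y j} (inj₁ refl) = trans (prepend-skip (suc a) (const u1v1) _ refl) (prepend-toℕ u2y _ j)
  decoded {e = u2y j} (inj₂ refl) = refl
  decoded {e = u0z k} (inj₁ refl) = trans (prepend-skip (suc a) u0x _ refl) (prepend-toℕ u0z _ k)
  decoded {e = u0z k} (inj₂ refl) = refl
  decoded {e = u3z k} (inj₁ refl) = trans (prepend-skip (suc (suc a)) (const u1v1) _ refl) (prepend-toℕ u3z _ k)
  decoded {e = u3z k} (inj₂ refl) = refl
  decoded {e = u1v1}  (inj₁ refl) = refl
  decoded {e = u1v1}  (inj₂ refl) = refl
  decoded {e = v1u2}  (inj₁ refl) = refl
  decoded {e = v1u2}  (inj₂ refl) = prepend-skip (suc a) (const u1v1) _ (+-identityʳ _)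
  decoded {e = u2v2}  (inj₁ refl) = prepend-skip (suc a) (const u1v1) _ (+-comm _ 1)
  decoded {e = u2v2}  (inj₂ refl) = refl
  decoded {e = v2u3}  (inj₁ refl) = refl
  decoded {e = v2u3}  (inj₂ refl) = prepend-skip (suc a) (const u1v1) _ (+-comm _ 1)
  decoded {e = u3v3}  (inj₁ refl) = prepend-skip (suc a) (const u1v1) _ (+-identityʳ _)
  decoded {e = u3v3}  (inj₂ refl) = refl
  decoded {e = v3u1}  (inj₁ refl) = refl
  decoded {e = v3u1}  (inj₂ refl) = prepend-skip (suc a) u1x _ (+-identityʳ _)

  intervals : ∀ v → IntervalAt G col v
  intervals u0 = two-classes-interval G col key (layout u0) decoded
    (realises-gap not-here (realises-run (λ _ → inj₁ refl , refl)
      (realises-last-run (λ _ → inj₁ refl , refl) not-here)))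
    (realises-gap not-here (realises-last-run (λ _ → inj₁ refl , refl) not-here))
    (s≤s z≤n) (m≤n⇒m≤1+n (s≤s (m≤m+n a _)))
    where not-here = λ { (inj₁ ()) ; (inj₂ ()) }
  intervals u1 = two-classes-interval G col key (layout u1) decoded
    (realises-single (inj₁ refl))
    (realises-gap not-here (realises-run (λ _ → inj₁ refl , refl)
      (realises-last-run (λ { 0F → inj₂ refl , sym (+-identityʳ _) }) not-here)))
    (s≤s (s≤s (m≤m+n a 1))) (s≤s z≤n)
    where not-here = λ { (inj₁ ()) ; (inj₂ ()) }
  intervals u2 = two-classes-interval G col key (layout u2) decoded
    (realises-gap not-here (realises-last-run (λ _ → inj₁ refl , refl) not-here))
    (realises-gap not-here (realises-last-run
      (λ { 0F → inj₂ refl , sym (+-identityʳ _) ; 1F → inj₁ refl , sym (+-comm _ 1) }) not-here))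
    (m≤m+n _ _) (m≤m+n _ _)
    where not-here = λ { (inj₁ ()) ; (inj₂ ()) }
  intervals u3 = two-classes-interval G col key (layout u3) decoded
    (realises-gap not-here (realises-last-run
      (λ { 0F → inj₁ refl , sym (+-identityʳ _) ; 1F → inj₂ refl , sym (+-comm _ 1) }) not-here))
    (realises-gap not-here (realises-last-run (λ _ → inj₁ refl , refl) not-here))
    (≤-trans (n≤1+n _) (m≤m+n _ _)) (subst (suc (suc a) ≤_) (+-comm 2 (suc a)) (n≤1+n _))
    where not-here = λ { (inj₁ ()) ; (inj₂ ()) }
  intervals v1 = two-classes-interval G col key (layout v1) decoded
    (realises-single (inj₂ refl)) (realises-single (inj₁ refl)) ≤-refl (≤-trans (n≤1+n _) (n≤1+n _))
  intervals v2 = two-classes-interval G col key (layout v2) decoded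
    (realises-single (inj₁ refl)) (realises-single (inj₂ refl)) (n≤1+n _) (n≤1+n _)
  intervals v3 = two-classes-interval G col key (layout v3) decoded
    (realises-single (inj₂ refl)) (realises-single (inj₁ refl)) (≤-trans (n≤1+n _) (n≤1+n _)) ≤-refl
  intervals (x i) = two-classes-interval G col key (layout (x i)) decoded
    (realises-single (inj₂ refl)) (realises-single (inj₂ refl)) (n≤1+n _) (n≤1+n _)
  intervals (y j) = two-classes-interval G col key (layout (y j)) decoded
    (realises-single (inj₂ refl)) (realises-single (inj₂ refl)) (n≤1+n _) (n≤1+n _)
  intervals (z k) = two-classes-interval G col key (layout (z k)) decoded
    (realises-single (inj₂ refl)) (realises-single (inj₂ refl)) (n≤1+n _) (n≤1+n _)

  colouring : HasImproperInterval 2 G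
  colouring = decoding⇒improper-interval G col key layout decoded intervals

module M-colouring (a b c : ℕ) where

  G : Graph
  G = M (suc a) (suc b) (suc c)

  col : E G → ℕ
  col (u0x i) = suc (toℕ i)
  col (u2x i) = suc (toℕ i)
  col (u1x i) = suc (suc (toℕ i))
  col (u0y j) = suc (a + toℕ j)
  col (u2y j) = suc (a + toℕ j)
  col (u3y j) = suc (suc (a + toℕ j))
  col (u0z k) = suc (suc (a + toℕ k))
  col (u3z k) = suc (suc (a + toℕ k))
  col (u1z k) = suc (suc (suc (a + toℕ k)))

  key : E G → Fin 2
  key (u0x _) = 0F
  key (u1x _) = 0F
  key (u2x _) = 1F
  key (u0y _) = 1F
  key (u2y _) = 0F
  key (u3y _) = 0F
  key (u0z _) = 0F
  key (u3z _) = 1F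
  key (u1z _) = 0F

  layout : V G → Fin 2 → Layout (E G)
  layout u0 0F    = gap 1 (u1x 0F) (run (suc a) u0x (run (suc c) u0z (rest (u1x 0F))))
  layout u0 1F    = gap (suc a) (u1x 0F) (run (suc b) u0y (rest (u1x 0F)))
  layout u1 0F    = gap 2 (u0x 0F) (run (suc a) u1x (run (suc c) u1z (rest (u0x 0F))))
  layout u1 1F    = rest (u0x 0F)
  layout u2 0F    = gap (suc a) (u0x 0F) (run (suc b) u2y (rest (u0x 0F)))
  layout u2 1F    = gap 1 (u0x 0F) (run (suc a) u2x (rest (u0x 0F)))
  layout u3 0F    = gap (suc (suc a)) (u0x 0F) (run (suc b) u3y (rest (u0x 0F)))
  layout u3 1F    = gap (suc (suc a)) (u0x 0F) (run (suc c) u3z (rest (u0x 0F)))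
  layout (x i) 0F = gap (suc (toℕ i)) (u0y 0F) (run 2 (u0x i ∷ u1x i ∷ []) (rest (u0y 0F)))
  layout (x i) 1F = rest (u2x i)
  layout (y j) 0F = gap (suc (a + toℕ j)) (u0x 0F) (run 2 (u2y j ∷ u3y j ∷ []) (rest (u0x 0F)))
  layout (y j) 1F = rest (u0y j)
  layout (z k) 0F = gap (suc (suc (a + toℕ k))) (u0x 0F) (run 2 (u0z k ∷ u1z k ∷ []) (rest (u0x 0F)))
  layout (z k) 1F = rest (u3z k)

  decoded : ∀ {v e} → Incident G v e → ⟦ layout v (key e) ⟧ (col e) ≡ e
  decoded {e = u0x i} (inj₁ refl) = prepend-toℕ u0x _ i
  decoded {e = u0x i} (inj₂ refl) = prepend-skip (suc (toℕ i)) (const (u0y 0F)) _ (+-identityʳ _)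
  decoded {e = u1x i} (inj₁ refl) = prepend-toℕ u1x _ i
  decoded {e = u1x i} (inj₂ refl) = prepend-skip (suc (toℕ i)) (const (u0y 0F)) _ (+-comm _ 1)
  decoded {e = u2x i} (inj₁ refl) = prepend-toℕ u2x _ i
  decoded {e = u2x i} (inj₂ refl) = refl
  decoded {e = u0y j} (inj₁ refl) = trans (prepend-skip (suc a) (const (u1x 0F)) _ refl) (prepend-toℕ u0y _ j)
  decoded {e = u0y j} (inj₂ refl) = refl
  decoded {e = u2y j} (inj₁ refl) = trans (prepend-skip (suc a) (const (u0x 0F)) _ refl) (prepend-toℕ u2y _ j)
  decoded {e = u2y j} (inj₂ refl) = prepend-skip (suc (a + toℕ j)) (const (u0x 0F)) _ (+-identityʳ _)
  decoded {e = u3y j} (inj₁ refl) = trans (prepend-skip (suc (suc a)) (const (u0x 0F)) _ refl) (prepend-toℕ u3y _ j)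
  decoded {e = u3y j} (inj₂ refl) = prepend-skip (suc (a + toℕ j)) (const (u0x 0F)) _ (+-comm _ 1)
  decoded {e = u0z k} (inj₁ refl) = trans (prepend-skip (suc a) u0x _ refl) (prepend-toℕ u0z _ k)
  decoded {e = u0z k} (inj₂ refl) = prepend-skip (suc (suc (a + toℕ k))) (const (u0x 0F)) _ (+-identityʳ _)
  decoded {e = u3z k} (inj₁ refl) = trans (prepend-skip (suc (suc a)) (const (u0x 0F)) _ refl) (prepend-toℕ u3z _ k)
  decoded {e = u3z k} (inj₂ refl) = refl
  decoded {e = u1z k} (inj₁ refl) = trans (prepend-skip (suc a) u1x _ refl) (prepend-toℕ u1z _ k)
  decoded {e = u1z k} (inj₂ refl) =
    prepend-skip (suc (suc (a + toℕ k))) (const (u0x 0F)) _ (+-comm (suc (suc (a + toℕ k))) 1)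

  intervals : ∀ v → IntervalAt G col v
  intervals u0 = two-classes-interval G col key (layout u0) decoded
    (realises-gap not-here (realises-run (λ _ → inj₁ refl , refl)
      (realises-last-run (λ _ → inj₁ refl , refl) not-here)))
    (realises-gap not-here (realises-last-run (λ _ → inj₁ refl , refl) not-here))
    (s≤s z≤n) (m≤n⇒m≤1+n (s≤s (m≤m+n a _)))
    where not-here = λ { (inj₁ ()) ; (inj₂ ()) }
  intervals u1 = two-classes-interval G col key (layout u1) decoded
    (realises-gap not-here (realises-run (λ _ → inj₁ refl , refl)
      (realises-last-run (λ _ → inj₁ refl , refl) not-here)))
    -- u₁ only has class-0 edges; the empty class is placed where it touches the other one
    (realises-empty {lo = 2} not-here)
    ≤-refl (m≤m+n _ _)
    where not-here = λ { (inj₁ ()) ; (inj₂ ()) }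
  intervals u2 = two-classes-interval G col key (layout u2) decoded
    (realises-gap not-here (realises-last-run (λ _ → inj₁ refl , refl) not-here))
    (realises-gap not-here (realises-last-run (λ _ → inj₁ refl , refl) not-here))
    (n≤1+n _) (s≤s z≤n)
    where not-here = λ { (inj₁ ()) ; (inj₂ ()) }
  intervals u3 = two-classes-interval G col key (layout u3) decoded
    (realises-gap not-here (realises-last-run (λ _ → inj₁ refl , refl) not-here))
    (realises-gap not-here (realises-last-run (λ _ → inj₁ refl , refl) not-here))
    (m≤m+n _ _) (m≤m+n _ _)
    where not-here = λ { (inj₁ ()) ; (inj₂ ()) }
  intervals (x i) = two-classes-interval G col key (layout (x i)) decoded
    (realises-gap not-here (realises-last-run
      (λ { 0F → inj₂ refl , sym (+-identityʳ _) ; 1F → inj₂ refl , sym (+-comm _ 1) }) not-here))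
    (realises-single (inj₂ refl))
    (n≤1+n _) (m≤m+n _ _)
    where not-here = λ { (inj₁ ()) ; (inj₂ ()) }
  intervals (y j) = two-classes-interval G col key (layout (y j)) decoded
    (realises-gap not-here (realises-last-run
      (λ { 0F → inj₂ refl , sym (+-identityʳ _) ; 1F → inj₂ refl , sym (+-comm _ 1) }) not-here))
    (realises-single (inj₂ refl))
    (n≤1+n _) (m≤m+n _ _)
    where not-here = λ { (inj₁ ()) ; (inj₂ ()) }
  intervals (z k) = two-classes-interval G col key (layout (z k)) decoded
    (realises-gap not-here (realises-last-run
      (λ { 0F → inj₂ refl , sym (+-identityʳ _) ; 1F → inj₂ refl , sym (+-comm _ 1) }) not-here))
    (realises-single (inj₂ refl))
    (n≤1+n _) (m≤m+n _ _)
    where not-here = λ { (inj₁ ()) ; (inj₂ ()) }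

  colouring : HasImproperInterval 2 G
  colouring = decoding⇒improper-interval G col key layout decoded intervals

theorem7 : (a b c : ℕ) → 1 ≤ a → 1 ≤ b → 1 ≤ c →
    μint≤ (S a b c) 2 × μint≤ (M a b c) 2
theorem7 (suc a) (suc b) (suc c) _ _ _ =
  (2 , ≤-refl , S-colouring.colouring a b c) , (2 , ≤-refl , M-colouring.colouring a b c)
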